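{- Let $m$ be real and let $\alpha_0,\alpha_1,\ldots$ be real numbers. Then for all integers $n\ge k\ge1$, \[ L_{m,\bar{\alpha}}(n+1,k)=L_{m,\bar{\alpha}}(n,k-1)+\big(\alpha_k+\alpha_n+(k+n)m\big)L_{m,\bar{\alpha}}(n,k), \] and for all $n\ge0$, \[ L_{m,\bar{\alpha}}(n,0)=\prod_{i=0}^{n-1}(\alpha_0+\alpha_i+im). \]
   Context: For real $m$ and reals $\bar{\alpha}=(\alpha_0,\alpha_1,\ldots)$ let $(x;\bar{\alpha}|m)_n=\prod_{j=0}^{n-1}(x-\alpha_j-jm)$ with $(x;\bar{\alpha}|m)_0=1$. The $\bar{\alpha}$-Whitney numbers of the first kind $w_{m,\bar{\alpha}}(n,k)$ and second kind $W_{m,\bar{\alpha}}(n,k)$ are defined by $(x;\bar{\alpha}|m)_n=\sum_{k=0}^n w_{m,\bar{\alpha}}(n,k)x^k$ and $x^n=\sum_{k=0}^n W_{m,\bar{\alpha}}(n,k)(x;\bar{\alpha}|m)_k$ (both zero for $k>n$ or $k<0$). The $\bar{\alpha}$-Whitney-Lah numbers are $L_{m,\bar{\alpha}}(n,k)=\sum_{j=k}^n(-1)^{n-j}w_{m,\bar{\alpha}}(n,j)W_{m,\bar{\alpha}}(j,k)$, with $L_{m,\bar{\alpha}}(0,0)=1$ and $L_{m,\bar{\alpha}}(n,k)=0$ for $n<k$ or $k<0$. -}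

module Defs where

open import Level using (Level)
open import Data.Nat using (ℕ; zero; suc) renaming (_+_ to _+ℕ_; _∸_ to _∸ℕ_)
open import Algebra.Bundles using (CommutativeRing)

module Whitney {c ℓ : Level} (R : CommutativeRing c ℓ)
               (m : CommutativeRing.Carrier R)
               (α : ℕ → CommutativeRing.Carrier R) where
  open CommutativeRing R hiding (zero)

  nat : ℕ → Carrier
  nat zero = 0#
  nat (suc n) = 1# + nat n

  sum< : ℕ → (ℕ → Carrier) → Carrier
  sum< zero f = 0#
  sum< (suc n) f = sum< n f + f n

  prod< : ℕ → (ℕ → Carrier) → Carrier
  prod< zero f = 1#
  prod< (suc n) f = prod< n f * f n

  -- Σ_{j=k}^{n} f j   (empty, i.e. 0, when n < k)
  sumFromTo : ℕ → ℕ → (ℕ → Carrier) → Carrier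
  sumFromTo k n f = sum< (suc n ∸ℕ k) (λ i → f (k +ℕ i))

  negOnePow : ℕ → Carrier
  negOnePow zero = 1#
  negOnePow (suc e) = - negOnePow e

  -- Polynomials in x over R, as coefficient sequences (coefficient of x^j).
  Poly : Set c
  Poly = ℕ → Carrier

  -- multiply a polynomial by (x - a)
  mulLin : Carrier → Poly → Poly
  mulLin a p zero = - (a * p zero)
  mulLin a p (suc j) = p j + - (a * p (suc j))

  xpow : ℕ → Poly
  xpow zero zero = 1#
  xpow zero (suc j) = 0#
  xpow (suc n) zero = 0#
  xpow (suc n) (suc j) = xpow n j

  -- the generalized falling factorial (x; ᾱ | m)_n = Π_{j<n} (x - α_j - j m)
  fallPoly : ℕ → Poly
  fallPoly zero = xpow zero
  fallPoly (suc n) = mulLin (α n + nat n * m) (fallPoly n)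

  -- ᾱ-Whitney numbers of the first kind: coefficient of x^k in (x;ᾱ|m)_n
  w : ℕ → ℕ → Carrier
  w n k = fallPoly n k

  -- W is (the table of) ᾱ-Whitney numbers of the second kind:
  -- W(n,k) = 0 for k > n, and x^n = Σ_{k=0}^{n} W(n,k) (x;ᾱ|m)_k
  -- as an identity of polynomials (coefficientwise).
  -- (These conditions determine W uniquely, since (x;ᾱ|m)_k is monic of degree k.)
  record IsWhitney2 (W : ℕ → ℕ → Carrier) : Set (c Level.⊔ ℓ) where
    field
      vanish : ∀ n k → suc n Data.Nat.≤ k → W n k ≈ 0#
      expand : ∀ n j → xpow n j ≈ sum< (suc n) (λ k → W n k * fallPoly k j)

  L : (ℕ → ℕ → Carrier) → ℕ → ℕ → Carrier
  L W n k = sumFromTo k n (λ j → negOnePow (n ∸ℕ j) * w n j * W j k)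

-- Put a_k = α_k + k m and s(n,j) = (-1)^(n-j) w(n,j). Both triangular arrays obey recurrences
-- with the roots a_k:
--   s(n+1,j+1) = s(n,j) + a_n s(n,j+1),   from (x;ᾱ|m)_{n+1} = (x - a_n) (x;ᾱ|m)_n;
--   W(j+1,k) = W(j,k-1) + a_k W(j,k),    from expanding x^{j+1} = x · x^j in the triangular basis
--                                        (x;ᾱ|m)_k, where x (x;ᾱ|m)_k = (x;ᾱ|m)_{k+1} + a_k (x;ᾱ|m)_k.
-- Substituting both into L(n+1,k) = Σ_j s(n+1,j) W(j,k) gives L(n,k-1) + (a_n + a_k) L(n,k).
-- For k = 0 the first summand is absent, so L(n,0) is the product of the a_0 + a_i.
module Submission where

open import Defs
open import Level using (Level)
open import Data.Nat using (ℕ; zero; suc; _≤_; _<_; z≤n; s≤s; _<?_) renaming (_+_ to _+ℕ_; _∸_ to _∸ℕ_)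
open import Data.Nat.Properties using (n<1+n; m<n⇒m<1+n; m≤n⇒m≤1+n; n≤1+n; ≤-trans; ≮⇒≥; m≤n⇒m<n∨m≡n; m+[n∸m]≡n)
import Data.Nat.Properties as ℕ
open import Data.Product using (_×_; _,_)
open import Data.Sum using (inj₁; inj₂)
open import Relation.Nullary using (yes; no; contradiction)
import Relation.Binary.PropositionalEquality as P
open import Algebra.Bundles using (CommutativeRing)

module WhitneyLah {c ℓ : Level} (R : CommutativeRing c ℓ)
    (m : CommutativeRing.Carrier R) (α : ℕ → CommutativeRing.Carrier R) where
  open CommutativeRing R hiding (zero)
  open Whitney R m α
  open import Algebra.Properties.Group +-group using (∙-cancelʳ; ε⁻¹≈ε; ⁻¹-involutive)
  open import Algebra.Properties.Ring ring using (-‿distribˡ-*; -‿distribʳ-*)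
  open import Relation.Binary.Reasoning.Setoid setoid
  open import Algebra.Properties.CommutativeSemigroup +-commutativeSemigroup using (interchange)
  open import Algebra.Properties.CommutativeSemigroup *-commutativeSemigroup using (x∙yz≈y∙xz)

  neg-*-neg : ∀ x y → - x * - y ≈ x * y
  neg-*-neg x y =
    trans (sym (-‿distribˡ-* x (- y))) (trans (-‿cong (sym (-‿distribʳ-* x y))) (⁻¹-involutive _))

  *-distribʳ-*+ : ∀ z x a y → (x + a * y) * z ≈ x * z + a * (y * z)
  *-distribʳ-*+ z x a y = trans (distribʳ z x _) (+-cong refl (*-assoc a y z))

  *-distribˡ-*+ : ∀ z x a y → z * (x + a * y) ≈ z * x + a * (z * y)
  *-distribˡ-*+ z x a y = trans (distribˡ z x _) (+-cong refl (x∙yz≈y∙xz z a y))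

  sum<-cong : ∀ n {f g : ℕ → Carrier} → (∀ j → f j ≈ g j) → sum< n f ≈ sum< n g
  sum<-cong zero    f≈g = refl
  sum<-cong (suc n) f≈g = +-cong (sum<-cong n f≈g) (f≈g n)

  sum<-vanish : ∀ n (f : ℕ → Carrier) → (∀ j → j < n → f j ≈ 0#) → sum< n f ≈ 0#
  sum<-vanish zero    f f≈0 = refl
  sum<-vanish (suc n) f f≈0 =
    trans (+-cong (sum<-vanish n f (λ j j<n → f≈0 j (m<n⇒m<1+n j<n))) (f≈0 n (n<1+n n)))
          (+-identityʳ 0#)

  sum<-+ : ∀ n (f g : ℕ → Carrier) → sum< n (λ j → f j + g j) ≈ sum< n f + sum< n g
  sum<-+ zero    f g = sym (+-identityʳ 0#)
  sum<-+ (suc n) f g = trans (+-cong (sum<-+ n f g) refl) (interchange _ _ _ _)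

  sum<-*ˡ : ∀ n a (f : ℕ → Carrier) → sum< n (λ j → a * f j) ≈ a * sum< n f
  sum<-*ˡ zero    a f = sym (zeroʳ a)
  sum<-*ˡ (suc n) a f = trans (+-cong (sum<-*ˡ n a f) refl) (sym (distribˡ a _ _))

  sum<-head : ∀ n (f : ℕ → Carrier) → sum< (suc n) f ≈ f 0 + sum< n (λ j → f (suc j))
  sum<-head zero    f = +-comm 0# (f 0)
  sum<-head (suc n) f = trans (+-cong (sum<-head n f) refl) (+-assoc _ _ _)

  sum<-last-vanish : ∀ n (f : ℕ → Carrier) → f n ≈ 0# → sum< (suc n) f ≈ sum< n f
  sum<-last-vanish n f fn≈0 = trans (+-cong refl fn≈0) (+-identityʳ _)

  sum<-drop-vanishing : ∀ k d (f : ℕ → Carrier) → (∀ j → j < k → f j ≈ 0#) →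
                        sum< (k +ℕ d) f ≈ sum< d (λ i → f (k +ℕ i))
  sum<-drop-vanishing k zero f f≈0 rewrite ℕ.+-identityʳ k = sum<-vanish k f f≈0
  sum<-drop-vanishing k (suc d) f f≈0 rewrite ℕ.+-suc k d =
    +-cong (sum<-drop-vanishing k d f f≈0) refl

  nat-+ : ∀ x y → nat (x +ℕ y) ≈ nat x + nat y
  nat-+ zero    y = sym (+-identityˡ _)
  nat-+ (suc x) y = trans (+-cong refl (nat-+ x y)) (sym (+-assoc _ _ _))

  root : ℕ → Carrier
  root k = α k + nat k * m

  root-+ : ∀ n k → root n + root k ≈ α k + α n + nat (k +ℕ n) * m
  root-+ n k = begin
    (α n + nat n * m) + (α k + nat k * m) ≈⟨ interchange _ _ _ _ ⟩
    (α n + α k) + (nat n * m + nat k * m) ≈⟨ +-cong (+-comm _ _) (trans (+-comm _ _) (sym (distribʳ m _ _))) ⟩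
    α k + α n + (nat k + nat n) * m       ≈⟨ +-cong refl (*-congʳ (sym (nat-+ k n))) ⟩
    α k + α n + nat (k +ℕ n) * m          ∎

  mulLin-suc : ∀ a (p : Poly) j → p (suc j) ≈ 0# → mulLin a p (suc j) ≈ p j
  mulLin-suc a p j p≈0 =
    trans (+-cong refl (trans (-‿cong (trans (*-congˡ p≈0) (zeroʳ a))) ε⁻¹≈ε))
          (+-identityʳ _)

  fallPoly-vanish : ∀ n j → n < j → fallPoly n j ≈ 0#
  fallPoly-vanish zero    (suc j) _ = refl
  fallPoly-vanish (suc n) (suc j) (s≤s n<j) =
    trans (mulLin-suc (root n) (fallPoly n) j (fallPoly-vanish n (suc j) (m<n⇒m<1+n n<j)))
          (fallPoly-vanish n j n<j)

  fallPoly-monic : ∀ n → fallPoly n n ≈ 1#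
  fallPoly-monic zero    = refl
  fallPoly-monic (suc n) =
    trans (mulLin-suc (root n) (fallPoly n) n (fallPoly-vanish n (suc n) (n<1+n n))) (fallPoly-monic n)

  combination-top : ∀ n (a : ℕ → Carrier) → sum< (suc n) (λ k → a k * fallPoly k n) ≈ a n
  combination-top n a = begin
    sum< n (λ k → a k * fallPoly k n) + a n * fallPoly n n
      ≈⟨ +-cong (sum<-vanish n _ (λ k k<n → trans (*-congˡ (fallPoly-vanish k n k<n)) (zeroʳ _)))
                (*-congˡ (fallPoly-monic n)) ⟩
    0# + a n * 1#                                        ≈⟨ trans (+-identityˡ _) (*-identityʳ _) ⟩
    a n                                                  ∎

  combination-top-unique : ∀ n (a b : ℕ → Carrier) →
    (∀ i → sum< (suc n) (λ k → a k * fallPoly k i) ≈ sum< (suc n) (λ k → b k * fallPoly k i)) →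
    a n ≈ b n
  combination-top-unique n a b a≈b =
    trans (sym (combination-top n a)) (trans (a≈b n) (combination-top n b))

  combination-unique : ∀ n (a b : ℕ → Carrier) →
    (∀ i → sum< n (λ k → a k * fallPoly k i) ≈ sum< n (λ k → b k * fallPoly k i)) →
    ∀ k → k < n → a k ≈ b k
  combination-unique (suc n) a b a≈b k (s≤s k≤n) with m≤n⇒m<n∨m≡n k≤n
  ... | inj₂ P.refl = combination-top-unique n a b a≈b
  ... | inj₁ k<n = combination-unique n a b lower k k<n
    where
    lower : ∀ i → sum< n (λ k → a k * fallPoly k i) ≈ sum< n (λ k → b k * fallPoly k i)
    lower i = ∙-cancelʳ (a n * fallPoly n i) _ _
      (trans (a≈b i) (+-cong refl (*-congʳ (sym (combination-top-unique n a b a≈b)))))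

  xMul : Poly → Poly
  xMul p zero    = 0#
  xMul p (suc i) = p i

  xMul-fallPoly : ∀ k i → xMul (fallPoly k) i ≈ fallPoly (suc k) i + root k * fallPoly k i
  xMul-fallPoly k zero    = sym (-‿inverseˡ _)
  xMul-fallPoly k (suc i) =
    sym (trans (+-assoc _ _ _) (trans (+-cong refl (-‿inverseˡ _)) (+-identityʳ _)))

  signed-w : ℕ → ℕ → Carrier
  signed-w n j = negOnePow (n ∸ℕ j) * w n j

  signed-w-vanish : ∀ n j → n < j → signed-w n j ≈ 0#
  signed-w-vanish n j n<j = trans (*-congˡ (fallPoly-vanish n j n<j)) (zeroʳ _)

  signed-w-zero : ∀ n → signed-w (suc n) 0 ≈ root n * signed-w n 0
  signed-w-zero n = trans (neg-*-neg _ _) (x∙yz≈y∙xz _ _ _)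

  signed-w-suc : ∀ n j → signed-w (suc n) (suc j) ≈ signed-w n j + root n * signed-w n (suc j)
  signed-w-suc n j with j <? n
  ... | yes j<n rewrite ℕ.+-∸-assoc 1 j<n =
    trans (distribˡ _ _ _) (+-cong refl (trans (neg-*-neg _ _) (x∙yz≈y∙xz _ _ _)))
  ... | no j≮n = begin
    negOnePow (n ∸ℕ j) * mulLin (root n) (fallPoly n) (suc j)
      ≈⟨ *-congˡ (mulLin-suc (root n) (fallPoly n) j (fallPoly-vanish n (suc j) n<1+j)) ⟩
    signed-w n j                                   ≈⟨ sym (+-identityʳ _) ⟩
    signed-w n j + 0#                              ≈⟨ +-cong refl (sym (trans (*-congˡ (signed-w-vanish n (suc j) n<1+j)) (zeroʳ _))) ⟩
    signed-w n j + root n * signed-w n (suc j)     ∎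
    where
    n<1+j : n < suc j
    n<1+j = s≤s (≮⇒≥ j≮n)

  module WithSecondKind (W : ℕ → ℕ → Carrier) (isW : IsWhitney2 W) where
    open IsWhitney2 isW

    -- W(j, k - 1), with the convention W(j, -1) = 0.
    Wpred : ℕ → ℕ → Carrier
    Wpred j zero    = 0#
    Wpred j (suc k) = W j k

    xpow-suc-expand : ∀ j i → xpow (suc j) i ≈ sum< (suc j) (λ k → W j k * xMul (fallPoly k) i)
    xpow-suc-expand j zero    = sym (sum<-vanish (suc j) _ (λ k _ → zeroʳ (W j k)))
    xpow-suc-expand j (suc i) = expand j i

    W-suc : ∀ j k → W (suc j) k ≈ Wpred j k + root k * W j k
    W-suc j k with k <? suc (suc j)
    ... | yes k<j+2 = combination-unique (suc (suc j)) (W (suc j)) (λ k → Wpred j k + root k * W j k)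
                        expansions k k<j+2
      where
      expansions : ∀ i → sum< (suc (suc j)) (λ k → W (suc j) k * fallPoly k i)
                       ≈ sum< (suc (suc j)) (λ k → (Wpred j k + root k * W j k) * fallPoly k i)
      expansions i = begin
        sum< (suc (suc j)) (λ k → W (suc j) k * fallPoly k i)
          ≈⟨ sym (expand (suc j) i) ⟩
        xpow (suc j) i
          ≈⟨ xpow-suc-expand j i ⟩
        sum< (suc j) (λ k → W j k * xMul (fallPoly k) i)
          ≈⟨ sum<-cong (suc j) (λ k → trans (*-congˡ (xMul-fallPoly k i)) (*-distribˡ-*+ (W j k) _ _ _)) ⟩
        sum< (suc j) (λ k → W j k * fallPoly (suc k) i + root k * (W j k * fallPoly k i))
          ≈⟨ sum<-+ (suc j) _ _ ⟩
        sum< (suc j) (λ k → W j k * fallPoly (suc k) i) + sum< (suc j) (λ k → root k * (W j k * fallPoly k i))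
          ≈⟨ +-cong (sym (trans (sum<-head (suc j) _) (trans (+-cong (zeroˡ _) refl) (+-identityˡ _))))
                    (sym (sum<-last-vanish (suc j) _
                           (trans (*-congˡ (trans (*-congʳ (vanish j (suc j) (n<1+n j))) (zeroˡ _))) (zeroʳ _)))) ⟩
        sum< (suc (suc j)) (λ k → Wpred j k * fallPoly k i) + sum< (suc (suc j)) (λ k → root k * (W j k * fallPoly k i))
          ≈⟨ sym (sum<-+ (suc (suc j)) _ _) ⟩
        sum< (suc (suc j)) (λ k → Wpred j k * fallPoly k i + root k * (W j k * fallPoly k i))
          ≈⟨ sum<-cong (suc (suc j)) (λ k → sym (*-distribʳ-*+ (fallPoly k i) _ _ _)) ⟩
        sum< (suc (suc j)) (λ k → (Wpred j k + root k * W j k) * fallPoly k i) ∎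
    W-suc j zero    | no 0≮j+2 = contradiction (s≤s z≤n) 0≮j+2
    W-suc j (suc k) | no k≮j+2 = begin
      W (suc j) (suc k)          ≈⟨ vanish (suc j) (suc k) j+1<k+1 ⟩
      0#                         ≈⟨ sym (+-identityʳ 0#) ⟩
      0# + 0#                    ≈⟨ sym (+-cong (vanish j k j<k) (trans (*-congˡ (vanish j (suc k) (m<n⇒m<1+n j<k))) (zeroʳ _))) ⟩
      W j k + root (suc k) * W j (suc k) ∎
      where
      j+1<k+1 : suc j < suc k
      j+1<k+1 = ≮⇒≥ k≮j+2
      j<k : j < k
      j<k = ℕ.≤-pred j+1<k+1

    lahSum : ℕ → ℕ → Carrier
    lahSum n k = sum< (suc n) (λ j → signed-w n j * W j k)

    lahSumPred : ℕ → ℕ → Carrier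
    lahSumPred n k = sum< (suc n) (λ j → signed-w n j * Wpred j k)

    -- For k ≤ n + 1 the terms j < k of the full sum vanish, since W(j,k) = 0 there.
    L≈lahSum : ∀ n k → k ≤ suc n → L W n k ≈ lahSum n k
    L≈lahSum n k k≤n+1 = sym (begin
      sum< (suc n) g                       ≡⟨ P.cong (λ N → sum< N g) (P.sym (m+[n∸m]≡n k≤n+1)) ⟩
      sum< (k +ℕ (suc n ∸ℕ k)) g           ≈⟨ sum<-drop-vanishing k (suc n ∸ℕ k) g
                                                 (λ j j<k → trans (*-congˡ (vanish j k j<k)) (zeroʳ _)) ⟩
      sum< (suc n ∸ℕ k) (λ i → g (k +ℕ i)) ∎)
      where
      g : ℕ → Carrier
      g j = signed-w n j * W j k

    lahSum-head : ∀ n k →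
      signed-w n 0 * W 0 k + sum< (suc n) (λ j → signed-w n (suc j) * W (suc j) k) ≈ lahSum n k
    lahSum-head n k = begin
      signed-w n 0 * W 0 k + sum< (suc n) (λ j → signed-w n (suc j) * W (suc j) k)
        ≈⟨ sym (sum<-head (suc n) _) ⟩
      sum< (suc (suc n)) (λ j → signed-w n j * W j k)
        ≈⟨ sum<-last-vanish (suc n) _ (trans (*-congʳ (signed-w-vanish n (suc n) (n<1+n n))) (zeroˡ _)) ⟩
      lahSum n k ∎

    lahSum-suc : ∀ n k → lahSum (suc n) k ≈ lahSumPred n k + (root n + root k) * lahSum n k
    lahSum-suc n k = begin
      lahSum (suc n) k
        ≈⟨ sum<-head (suc n) _ ⟩
      signed-w (suc n) 0 * W 0 k + sum< (suc n) (λ j → signed-w (suc n) (suc j) * W (suc j) k)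
        ≈⟨ +-cong (trans (*-congʳ (signed-w-zero n)) (*-assoc _ _ _)) (sum<-cong (suc n) term) ⟩
      root n * a + sum< (suc n) (λ j → (p j + root k * l j) + root n * b j)
        ≈⟨ +-cong refl (trans (sum<-+ (suc n) _ _)
                 (+-cong (trans (sum<-+ (suc n) _ _) (+-cong refl (sum<-*ˡ (suc n) _ _))) (sum<-*ˡ (suc n) _ _))) ⟩
      root n * a + ((lahSumPred n k + root k * lahSum n k) + root n * sum< (suc n) b)
        ≈⟨ trans (+-comm _ _) (trans (+-assoc _ _ _) (+-cong refl (sym (distribˡ _ _ _)))) ⟩
      (lahSumPred n k + root k * lahSum n k) + root n * (sum< (suc n) b + a)
        ≈⟨ +-cong refl (*-congˡ (trans (+-comm _ _) (lahSum-head n k))) ⟩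
      (lahSumPred n k + root k * lahSum n k) + root n * lahSum n k
        ≈⟨ trans (+-assoc _ _ _) (+-cong refl (trans (+-comm _ _) (sym (distribʳ _ _ _)))) ⟩
      lahSumPred n k + (root n + root k) * lahSum n k ∎
      where
      a : Carrier
      a = signed-w n 0 * W 0 k
      p l b : ℕ → Carrier
      p j = signed-w n j * Wpred j k
      l j = signed-w n j * W j k
      b j = signed-w n (suc j) * W (suc j) k
      term : ∀ j → signed-w (suc n) (suc j) * W (suc j) k ≈ (p j + root k * l j) + root n * b j
      term j = trans (*-congʳ (signed-w-suc n j))
                 (trans (*-distribʳ-*+ _ _ _ _) (+-cong (trans (*-congˡ (W-suc j k)) (*-distribˡ-*+ _ _ _ _)) refl))

    W-zero-zero : W 0 0 ≈ 1#
    W-zero-zero = sym (trans (expand 0 0) (trans (+-identityˡ _) (*-identityʳ _)))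

    lahSum-zero : ∀ n → lahSum n 0 ≈ prod< n (λ i → α 0 + α i + nat i * m)
    lahSum-zero zero    = trans (+-identityˡ _) (trans (*-congʳ (*-identityˡ 1#)) (trans (*-identityˡ _) W-zero-zero))
    lahSum-zero (suc n) = begin
      lahSum (suc n) 0                                ≈⟨ lahSum-suc n 0 ⟩
      lahSumPred n 0 + (root n + root 0) * lahSum n 0 ≈⟨ +-cong (sum<-vanish (suc n) _ (λ j _ → zeroʳ _)) refl ⟩
      0# + (root n + root 0) * lahSum n 0             ≈⟨ +-identityˡ _ ⟩
      (root n + root 0) * lahSum n 0                  ≈⟨ *-cong (root-+ n 0) (lahSum-zero n) ⟩
      (α 0 + α n + nat n * m) * prod< n (λ i → α 0 + α i + nat i * m) ≈⟨ *-comm _ _ ⟩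
      prod< (suc n) (λ i → α 0 + α i + nat i * m)     ∎

    L-suc : ∀ n k → 1 ≤ k → k ≤ n →
            L W (suc n) k ≈ L W n (k ∸ℕ 1) + (α k + α n + nat (k +ℕ n) * m) * L W n k
    L-suc n (suc k) _ k<n = begin
      L W (suc n) (suc k)                         ≈⟨ L≈lahSum (suc n) (suc k) (m≤n⇒m≤1+n (m≤n⇒m≤1+n k<n)) ⟩
      lahSum (suc n) (suc k)                      ≈⟨ lahSum-suc n (suc k) ⟩
      lahSum n k + (root n + root (suc k)) * lahSum n (suc k)
        ≈⟨ +-cong (sym (L≈lahSum n k (m≤n⇒m≤1+n (≤-trans (n≤1+n k) k<n))))
                  (*-cong (root-+ n (suc k)) (sym (L≈lahSum n (suc k) (m≤n⇒m≤1+n k<n)))) ⟩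
      L W n k + (α (suc k) + α n + nat (suc k +ℕ n) * m) * L W n (suc k) ∎

    L-zero : ∀ n → L W n 0 ≈ prod< n (λ i → α 0 + α i + nat i * m)
    L-zero n = trans (L≈lahSum n 0 z≤n) (lahSum-zero n)

mainTheorem10 : ∀ {c ℓ : Level} (R : CommutativeRing c ℓ)
                  (m : CommutativeRing.Carrier R) (α : ℕ → CommutativeRing.Carrier R)
                  (W : ℕ → ℕ → CommutativeRing.Carrier R) →
                  Whitney.IsWhitney2 R m α W →
                  let open CommutativeRing R in let open Whitney R m α in
                  (∀ n k → 1 ≤ k → k ≤ n →
                    L W (suc n) k ≈ L W n (k ∸ℕ 1) + (α k + α n + nat (k +ℕ n) * m) * L W n k)
                  × (∀ n → L W n 0 ≈ prod< n (λ i → α 0 + α i + nat i * m))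
mainTheorem10 R m α W isW = L-suc , L-zero
  where open WhitneyLah.WithSecondKind R m α W isW
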